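{- For every integer $k\ge0$, as formal power series in $z$, $$\sum_{n\ge0}e(n,n-k)z^n=\frac{z^k}{(1-z)^{2\lfloor\frac{k+1}{2}\rfloor+1}(1+z^2)^{\lfloor\frac k2\rfloor+1}}\,L_{k+2}(-z),$$ where $L_m(x)=\sum_{j=0}^m L(m,j)x^j$.
   Context: $e(n,k)$ is the number of $k$-subsets of $\{1,\dots,n\}$ whose element sum is even (the empty set counts as even), with $e(n,k)=0$ for $k<0$. Losanitsch's triangle is defined by $L(0,j)=[j=0]$, $L(1,j)=[0\le j\le 1]$, $L(n,j)=0$ for $j<0$, and for $n\ge 2$ by $L(n,j)=L(n-2,j)+\binom{n-2}{j-1}+L(n-2,j-2)$ (with $\binom{m}{i}=0$ for $i<0$ or $i>m$). -}

module Defs where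

open import Data.Nat as ℕ using (ℕ; zero; suc; _∸_; _≡ᵇ_; _%_; _/_)
open import Data.Bool using (Bool; true; false; if_then_else_; _∧_)
open import Data.List using (List; []; _∷_; _++_; map; length)
open import Data.Nat.ListAction using (sum)
open import Data.Integer as ℤ using (ℤ; +_; -[1+_]; _+_; _*_; _-_; -_)

binom : ℕ → ℕ → ℕ
binom m zero = 1
binom zero (suc i) = 0
binom (suc m) (suc i) = binom m i ℕ.+ binom m (suc i)

binomℤ : ℕ → ℤ → ℕ
binomℤ m (+ i) = binom m i
binomℤ m -[1+ _ ] = 0

subsets : ℕ → List (List ℕ)
subsets zero = [] ∷ []
subsets (suc n) = subsets n ++ map (suc n ∷_) (subsets n)

countTrue : List Bool → ℕ
countTrue [] = 0
countTrue (true ∷ bs) = suc (countTrue bs)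
countTrue (false ∷ bs) = countTrue bs

e : ℕ → ℕ → ℕ
e n k = countTrue (map (λ s → (length s ≡ᵇ k) ∧ ((sum s % 2) ≡ᵇ 0)) (subsets n))

eℤ : ℕ → ℤ → ℕ
eℤ n (+ k) = e n k
eℤ n -[1+ _ ] = 0

L : ℕ → ℤ → ℕ
L zero (+ zero) = 1
L zero _ = 0
L (suc zero) (+ zero) = 1
L (suc zero) (+ suc zero) = 1
L (suc zero) _ = 0
L (suc (suc n)) -[1+ _ ] = 0
L (suc (suc n)) (+ j) = L n (+ j) ℕ.+ binomℤ n (+ j - + 1) ℕ.+ L n (+ j - + 2)

Series : Set
Series = ℕ → ℤ

sumBelow : ℕ → (ℕ → ℤ) → ℤ
sumBelow zero f = + 0
sumBelow (suc m) f = sumBelow m f + f m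

_⊛_ : Series → Series → Series
(f ⊛ g) n = sumBelow (suc n) (λ i → f i * g (n ∸ i))
infixl 7 _⊛_

oneS : Series
oneS zero = + 1
oneS (suc _) = + 0

_^S_ : Series → ℕ → Series
f ^S zero = oneS
f ^S suc m = f ⊛ (f ^S m)

zPow : ℕ → Series
zPow k n = if n ≡ᵇ k then + 1 else + 0

invOneMinusZ : Series
invOneMinusZ _ = + 1

-- 1/(1+z^2) = Σ_m (-1)^m z^(2m)  (the inverse of 1 + z^2)
invOnePlusZ² : Series
invOnePlusZ² n = if n % 2 ≡ᵇ 0 then (if (n / 2) % 2 ≡ᵇ 0 then + 1 else - + 1) else + 0

oneMinusZ : Series
oneMinusZ zero = + 1
oneMinusZ (suc zero) = - + 1
oneMinusZ (suc (suc _)) = + 0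

onePlusZ² : Series
onePlusZ² zero = + 1
onePlusZ² (suc zero) = + 0
onePlusZ² (suc (suc zero)) = + 1
onePlusZ² (suc (suc (suc _))) = + 0

sign : ℕ → ℤ
sign j = if j % 2 ≡ᵇ 0 then + 1 else - + 1

Lpoly-z : ℕ → Series
Lpoly-z m j = if j ℕ.≤ᵇ m then sign j * + L m (+ j) else + 0

lhsSeries : ℕ → Series
lhsSeries k n = + eℤ n (+ n - + k)

rhsSeries : ℕ → Series
rhsSeries k =
  zPow k ⊛ ((invOneMinusZ ^S (2 ℕ.* ((k ℕ.+ 1) / 2) ℕ.+ 1))
         ⊛ ((invOnePlusZ² ^S ((k / 2) ℕ.+ 1)) ⊛ Lpoly-z (k ℕ.+ 2)))

module Submission where

-- Write A = 1/(1-z), U = 1-z, V = 1+z², B = 1/(1+z²) and let δ(n,k) be the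
-- number of k-subsets of {1,…,n} with even sum minus the number with odd
-- sum.  Since 2·e(n,k) = C(n,k) + δ(n,k), doubling both sides reduces the
-- theorem to three generating-function identities:
--   (1) Σ_j C(k+j,j) zʲ = A^(k+1)                      (Pascal's rule),
--   (2) Σ_j δ(k+j,j) zʲ = D_k := (1-z)^(1-k mod 2) B^(⌊k/2⌋+1)
--       (δ obeys δ(n+2,j+2) = δ(n,j+2) − δ(n,j), i.e. (1+z²)D_{k+2} = D_k),
--   (3) 2·L_m(-z) = (1-z)^m + (1-z)^(m mod 2) V^⌊m/2⌋  (Losanitsch's rule).
-- With r = k mod 2 the right-hand side then becomes
--   z^k A^(k+1+r) B^b ((1-z)^r V^b + U^(k+2)),   b = ⌊k/2⌋+1,
-- which equals z^k (A^(k+1) + D_k) by the cancellations A·U = 1, B·V = 1.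

open import Defs
open import Data.Nat as ℕ using (ℕ; zero; suc; _∸_; _%_; _/_; _≡ᵇ_; _<_; s≤s)
import Data.Nat.Properties as ℕP
import Data.Nat.DivMod as ℕD
import Data.Nat.Tactic.RingSolver as ℕSolver
open import Data.Integer using (ℤ; +_; -[1+_]; _+_; _*_; _-_; -_)
import Data.Integer.Properties as ℤP
open import Data.Integer.Tactic.RingSolver using (solve-∀)
open import Data.Bool using (Bool; true; false; not; _∧_; T)
open import Data.List using (List; []; _∷_; _++_; map; length)
import Data.List.Properties as ListP
open import Data.Nat.ListAction using (sum)
open import Data.Product using (_,_)
open import Data.Sum using (inj₁; inj₂)
open import Level using (0ℓ)
open import Algebra.Bundles using (CommutativeRing)
import Algebra.Construct.Pointwise as Pointwise
import Algebra.Properties.Ring as RingProperties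
import Algebra.Solver.Ring.NaturalCoefficients.Default as NaturalCoefficientSolver
import Relation.Binary.Reasoning.Setoid as SetoidReasoning
open import Relation.Binary.PropositionalEquality

infix 4 _≐_
_≐_ : Series → Series → Set
f ≐ g = ∀ n → f n ≡ g n

≡⇒≐ : ∀ {f g} → f ≡ g → f ≐ g
≡⇒≐ refl n = refl

infixl 6 _⊕_
_⊕_ : Series → Series → Series
(f ⊕ g) n = f n + g n

⊖_ : Series → Series
(⊖ f) n = - f n

zeroS : Series
zeroS _ = + 0

twice : Series → Series
twice f = f ⊕ f

tail : Series → Series
tail f n = f (suc n)

infixr 7 _⋆_
_⋆_ : ℤ → Series → Series
(c ⋆ f) n = c * f n

infixl 7 _·_
_·_ : Series → Series → Series
(f · g) zero = f 0 * g 0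
(f · g) (suc n) = f 0 * g (suc n) + (tail f · g) n

⊕-cong : ∀ {f f′ g g′} → f ≐ f′ → g ≐ g′ → f ⊕ g ≐ f′ ⊕ g′
⊕-cong p q n = cong₂ _+_ (p n) (q n)

·-cong : ∀ {f f′ g g′} → f ≐ f′ → g ≐ g′ → f · g ≐ f′ · g′
·-cong p q zero = cong₂ _*_ (p 0) (q 0)
·-cong p q (suc n) = cong₂ _+_ (cong₂ _*_ (p 0) (q (suc n))) (·-cong (λ i → p (suc i)) q n)

·-congʳ : ∀ f {g g′} → g ≐ g′ → f · g ≐ f · g′
·-congʳ f = ·-cong (λ _ → refl)

·-zeroˡ : ∀ g → zeroS · g ≐ zeroS
·-zeroˡ g zero = ℤP.*-zeroˡ (g 0)
·-zeroˡ g (suc n) = cong₂ _+_ (ℤP.*-zeroˡ (g (suc n))) (·-zeroˡ g n)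

·-identityˡ : ∀ f → oneS · f ≐ f
·-identityˡ f zero = ℤP.*-identityˡ (f 0)
·-identityˡ f (suc n) =
  trans (cong₂ _+_ (ℤP.*-identityˡ (f (suc n))) (·-zeroˡ f n)) (ℤP.+-identityʳ (f (suc n)))

·-distribˡ : ∀ f g h → f · (g ⊕ h) ≐ f · g ⊕ f · h
·-distribˡ f g h zero = ℤP.*-distribˡ-+ (f 0) (g 0) (h 0)
·-distribˡ f g h (suc n) =
  trans (cong₂ _+_ (ℤP.*-distribˡ-+ (f 0) (g (suc n)) (h (suc n))) (·-distribˡ (tail f) g h n))
        (interchange (f 0 * g (suc n)) (f 0 * h (suc n)) ((tail f · g) n) ((tail f · h) n))
  where
  interchange : ∀ (a b c d : ℤ) → (a + b) + (c + d) ≡ (a + c) + (b + d)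
  interchange = solve-∀

·-distribʳ : ∀ f g h → (g ⊕ h) · f ≐ g · f ⊕ h · f
·-distribʳ f g h zero = ℤP.*-distribʳ-+ (f 0) (g 0) (h 0)
·-distribʳ f g h (suc n) =
  trans (cong₂ _+_ (ℤP.*-distribʳ-+ (f (suc n)) (g 0) (h 0)) (·-distribʳ f (tail g) (tail h) n))
        (interchange (g 0 * f (suc n)) (h 0 * f (suc n)) ((tail g · f) n) ((tail h · f) n))
  where
  interchange : ∀ (a b c d : ℤ) → (a + b) + (c + d) ≡ (a + c) + (b + d)
  interchange = solve-∀

·-scaleˡ : ∀ c f g → (c ⋆ f) · g ≐ c ⋆ (f · g)
·-scaleˡ c f g zero = ℤP.*-assoc c (f 0) (g 0)
·-scaleˡ c f g (suc n) =
  trans (cong₂ _+_ (ℤP.*-assoc c (f 0) (g (suc n))) (·-scaleˡ c (tail f) g n))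
        (sym (ℤP.*-distribˡ-+ c _ _))

-- Uses tail (f · g) = f₀ ⋆ tail g ⊕ tail f · g, which holds by definition.
·-assoc : ∀ f g h → (f · g) · h ≐ f · (g · h)
·-assoc f g h zero = ℤP.*-assoc (f 0) (g 0) (h 0)
·-assoc f g h (suc n) = begin
  f 0 * g 0 * h (suc n) + ((f 0 ⋆ tail g ⊕ tail f · g) · h) n
    ≡⟨ cong (_+_ (f 0 * g 0 * h (suc n))) (·-distribʳ h (f 0 ⋆ tail g) (tail f · g) n) ⟩
  f 0 * g 0 * h (suc n) + (((f 0 ⋆ tail g) · h) n + ((tail f · g) · h) n)
    ≡⟨ cong (_+_ (f 0 * g 0 * h (suc n))) (cong₂ _+_ (·-scaleˡ (f 0) (tail g) h n) (·-assoc (tail f) g h n)) ⟩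
  f 0 * g 0 * h (suc n) + (f 0 * (tail g · h) n + (tail f · (g · h)) n)
    ≡⟨ regroup (f 0) (g 0) (h (suc n)) _ _ ⟩
  f 0 * (g 0 * h (suc n) + (tail g · h) n) + (tail f · (g · h)) n ∎
  where
  open ≡-Reasoning
  regroup : ∀ (a b c d e : ℤ) → a * b * c + (a * d + e) ≡ a * (b * c + d) + e
  regroup = solve-∀

·-snoc : ∀ n f g → (f · g) (suc n) ≡ (f · tail g) n + f (suc n) * g 0
·-snoc zero f g = refl
·-snoc (suc n) f g =
  trans (cong (_+_ (f 0 * g (suc (suc n)))) (·-snoc n (tail f) g))
        (sym (ℤP.+-assoc (f 0 * g (suc (suc n))) _ _))

·-comm : ∀ f g → f · g ≐ g · f
·-comm f g zero = ℤP.*-comm (f 0) (g 0)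
·-comm f g (suc n) =
  trans (cong (_+_ (f 0 * g (suc n))) (·-comm (tail f) g n))
        (trans (swap (f 0) (g (suc n)) _) (sym (·-snoc n g f)))
  where
  swap : ∀ (a b c : ℤ) → a * b + c ≡ c + b * a
  swap = solve-∀

·-identityʳ : ∀ f → f · oneS ≐ f
·-identityʳ f n = trans (·-comm f oneS n) (·-identityˡ f n)

seriesRing : CommutativeRing 0ℓ 0ℓ
seriesRing = record
  { Carrier = Series
  ; _≈_ = _≐_
  ; _+_ = _⊕_
  ; _*_ = _·_
  ; -_ = ⊖_
  ; 0# = zeroS
  ; 1# = oneS
  ; isCommutativeRing = record
    { isRing = record
      { +-isAbelianGroup = Pointwise.isAbelianGroup ℕ ℤP.+-0-isAbelianGroup
      ; *-cong = ·-cong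
      ; *-assoc = ·-assoc
      ; *-identity = ·-identityˡ , ·-identityʳ
      ; distrib = ·-distribˡ , ·-distribʳ
      }
    ; *-comm = ·-comm
    }
  }

open CommutativeRing seriesRing using ()
  renaming (refl to ≐-refl; sym to ≐-sym; trans to ≐-trans)
open RingProperties (CommutativeRing.ring seriesRing) using (-‿distribˡ-*)
module ≐-Reasoning = SetoidReasoning (CommutativeRing.setoid seriesRing)
module SeriesSolver = NaturalCoefficientSolver (CommutativeRing.commutativeSemiring seriesRing)

sumBelow-cong : ∀ m (F G : ℕ → ℤ) → (∀ i → i < m → F i ≡ G i) → sumBelow m F ≡ sumBelow m G
sumBelow-cong zero F G p = refl
sumBelow-cong (suc m) F G p =
  cong₂ _+_ (sumBelow-cong m F G (λ i i<m → p i (ℕP.m<n⇒m<1+n i<m))) (p m ℕP.≤-refl)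

⊛≐· : ∀ f g → f ⊛ g ≐ f · g
⊛≐· f g zero = ℤP.+-identityˡ (f 0 * g 0)
⊛≐· f g (suc n) = begin
  sumBelow (suc n) (λ i → f i * g (suc n ∸ i)) + f (suc n) * g (suc n ∸ suc n)
    ≡⟨ cong₂ _+_ (sumBelow-cong (suc n) _ _ λ i i≤n → cong (λ x → f i * g x) (ℕP.+-∸-assoc 1 (ℕP.≤-pred i≤n)))
                 (cong (λ x → f (suc n) * g x) (ℕP.n∸n≡0 n)) ⟩
  (f ⊛ tail g) n + f (suc n) * g 0
    ≡⟨ cong (_+ (f (suc n) * g 0)) (⊛≐· f (tail g) n) ⟩
  (f · tail g) n + f (suc n) * g 0
    ≡⟨ sym (·-snoc n f g) ⟩
  (f · g) (suc n) ∎
  where open ≡-Reasoning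

infixr 8 _^_
_^_ : Series → ℕ → Series
f ^ zero = oneS
f ^ suc m = f · f ^ m

^S≐^ : ∀ f m → f ^S m ≐ f ^ m
^S≐^ f zero = ≐-refl
^S≐^ f (suc m) = ≐-trans (⊛≐· f (f ^S m)) (·-cong ≐-refl (^S≐^ f m))

^-cancel : ∀ {f g} → f · g ≐ oneS → ∀ n m → f ^ (n ℕ.+ m) · g ^ n ≐ f ^ m
^-cancel {f} fg≐1 zero m = ·-identityʳ (f ^ m)
^-cancel {f} {g} fg≐1 (suc n) m = begin
  (f · f ^ (n ℕ.+ m)) · (g · g ^ n)  ≈⟨ regroup f (f ^ (n ℕ.+ m)) g (g ^ n) ⟩
  (f · g) · (f ^ (n ℕ.+ m) · g ^ n)  ≈⟨ ·-cong fg≐1 (^-cancel fg≐1 n m) ⟩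
  oneS · f ^ m                       ≈⟨ ·-identityˡ (f ^ m) ⟩
  f ^ m                              ∎
  where
  open ≐-Reasoning
  open SeriesSolver using (solve; _:=_; _:*_)
  regroup : ∀ a b c d → (a · b) · (c · d) ≐ (a · c) · (b · d)
  regroup = solve 4 (λ a b c d → (a :* b) :* (c :* d) := (a :* c) :* (b :* d)) ≐-refl

^-inverse : ∀ {f g} → f · g ≐ oneS → ∀ n → f ^ n · g ^ n ≐ oneS
^-inverse {f} {g} fg≐1 n = subst (λ i → f ^ i · g ^ n ≐ oneS) (ℕP.+-identityʳ n) (^-cancel fg≐1 n 0)

U A V B : Series
U = oneMinusZ
A = invOneMinusZ
V = onePlusZ²
B = invOnePlusZ²

minusZ : Series
minusZ zero = + 0
minusZ (suc zero) = - + 1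
minusZ (suc (suc _)) = + 0

parity-suc : ∀ m → (suc m % 2 ≡ᵇ 0) ≡ not (m % 2 ≡ᵇ 0)
parity-suc zero = refl
parity-suc (suc zero) = refl
parity-suc (suc (suc m)) = parity-suc m

half-suc-suc : ∀ m → suc (suc m) / 2 ≡ suc (m / 2)
half-suc-suc m = ℕD.m/n≡1+[m∸n]/n {suc (suc m)} {2} (s≤s (s≤s ℕ.z≤n))

sign-suc : ∀ j → sign (suc j) ≡ - sign j
sign-suc j rewrite parity-suc j with j % 2 ≡ᵇ 0
... | true = refl
... | false = refl

B-suc-suc : tail (tail B) ≐ ⊖ B
B-suc-suc n rewrite half-suc-suc n | parity-suc (n / 2) with n % 2 ≡ᵇ 0 | (n / 2) % 2 ≡ᵇ 0
... | true | true = refl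
... | true | false = refl
... | false | _ = refl

·-coeff₀ : ∀ h f → h 0 ≡ + 1 → (h · f) 0 ≡ f 0
·-coeff₀ h f h₀ = trans (cong (_* f 0) h₀) (ℤP.*-identityˡ (f 0))

·-coeff₁ : ∀ h f → h 0 ≡ + 1 → h 1 ≡ + 0 → (h · f) 1 ≡ f 1
·-coeff₁ h f h₀ h₁ =
  trans (cong₂ (λ a b → a * f 1 + b * f 0) h₀ h₁) (leading-one (f 1) (f 0))
  where
  leading-one : ∀ (a b : ℤ) → + 1 * a + + 0 * b ≡ a
  leading-one = solve-∀

·-coeff₂ : ∀ h f n → h 0 ≡ + 1 → h 1 ≡ + 0 →
           (h · f) (suc (suc n)) ≡ f (suc (suc n)) + (tail (tail h) · f) n
·-coeff₂ h f n h₀ h₁ =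
  trans (cong₂ (λ a b → a * f (suc (suc n)) + (b * f (suc n) + (tail (tail h) · f) n)) h₀ h₁)
        (leading-one (f (suc (suc n))) (f (suc n)) ((tail (tail h) · f) n))
  where
  leading-one : ∀ (a b c : ℤ) → + 1 * a + (+ 0 * b + c) ≡ a + c
  leading-one = solve-∀

·-minus-one : ∀ h f n → h ≐ ⊖ oneS → (h · f) n ≡ - f n
·-minus-one h f n h≐-1 =
  trans (·-cong h≐-1 ≐-refl n) (trans (sym (-‿distribˡ-* oneS f n)) (cong -_ (·-identityˡ f n)))

U·-suc : ∀ f n → (U · f) (suc n) ≡ f (suc n) - f n
U·-suc f n = cong₂ _+_ (ℤP.*-identityˡ (f (suc n))) (·-minus-one (tail U) f n tail-U)
  where
  tail-U : tail U ≐ ⊖ oneS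
  tail-U zero = refl
  tail-U (suc n) = refl

minusZ·-suc : ∀ f n → (minusZ · f) (suc n) ≡ - f n
minusZ·-suc f n =
  trans (cong₂ _+_ (ℤP.*-zeroˡ (f (suc n))) (·-minus-one (tail minusZ) f n tail-minusZ))
        (ℤP.+-identityˡ (- f n))
  where
  tail-minusZ : tail minusZ ≐ ⊖ oneS
  tail-minusZ zero = refl
  tail-minusZ (suc n) = refl

A·-suc : ∀ f n → (A · f) (suc n) ≡ f (suc n) + (A · f) n
A·-suc f n = cong (_+ (A · f) n) (ℤP.*-identityˡ (f (suc n)))

V·-suc-suc : ∀ f n → (V · f) (suc (suc n)) ≡ f (suc (suc n)) + f n
V·-suc-suc f n =
  trans (·-coeff₂ V f n refl refl)
        (cong (_+_ (f (suc (suc n)))) (trans (·-cong tail²-V ≐-refl n) (·-identityˡ f n)))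
  where
  tail²-V : tail (tail V) ≐ oneS
  tail²-V zero = refl
  tail²-V (suc n) = refl

B·-suc-suc : ∀ f n → (B · f) (suc (suc n)) ≡ f (suc (suc n)) - (B · f) n
B·-suc-suc f n =
  trans (·-coeff₂ B f n refl refl)
        (cong (_+_ (f (suc (suc n))))
              (trans (·-cong B-suc-suc ≐-refl n) (sym (-‿distribˡ-* B f n))))

U·A≐1 : U · A ≐ oneS
U·A≐1 zero = refl
U·A≐1 (suc n) = U·-suc A n

B·V≐1 : B · V ≐ oneS
B·V≐1 zero = refl
B·V≐1 (suc zero) = refl
B·V≐1 (suc (suc zero)) = B·-suc-suc V 0
B·V≐1 (suc (suc (suc n))) = trans (B·-suc-suc V (suc n)) (cong (_-_ (+ 0)) (B·V≐1 (suc n)))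

U·U : U · U ≐ V ⊕ minusZ ⊕ minusZ
U·U zero = refl
U·U (suc zero) = U·-suc U 0
U·U (suc (suc zero)) = U·-suc U 1
U·U (suc (suc (suc n))) = U·-suc U (suc (suc n))

binom-vanish : ∀ m i → m < i → binom m i ≡ 0
binom-vanish zero (suc i) _ = refl
binom-vanish (suc m) (suc i) (s≤s m<i) =
  cong₂ ℕ._+_ (binom-vanish m i m<i) (binom-vanish m (suc i) (ℕP.m<n⇒m<1+n m<i))

U^-coeff : ∀ m j → (U ^ m) j ≡ sign j * + binom m j
U^-coeff zero zero = refl
U^-coeff zero (suc j) = sym (ℤP.*-zeroʳ (sign (suc j)))
U^-coeff (suc m) zero = trans (ℤP.*-identityˡ ((U ^ m) 0)) (U^-coeff m zero)
U^-coeff (suc m) (suc j) = begin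
  (U · U ^ m) (suc j)                                   ≡⟨ U·-suc (U ^ m) j ⟩
  (U ^ m) (suc j) - (U ^ m) j                           ≡⟨ cong₂ _-_ (U^-coeff m (suc j)) (U^-coeff m j) ⟩
  sign (suc j) * + binom m (suc j) - sign j * + binom m j ≡⟨ cong (λ s → s * + binom m (suc j) - sign j * + binom m j) (sign-suc j) ⟩
  - sign j * + binom m (suc j) - sign j * + binom m j   ≡⟨ pascal (sign j) (+ binom m j) (+ binom m (suc j)) ⟩
  - sign j * (+ binom m j + + binom m (suc j))           ≡⟨ cong₂ _*_ (sym (sign-suc j)) (sym (ℤP.pos-+ (binom m j) (binom m (suc j)))) ⟩
  sign (suc j) * + binom (suc m) (suc j)                 ∎
  where
  open ≡-Reasoning
  pascal : ∀ (s a b : ℤ) → - s * b - s * a ≡ - s * (a + b)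
  pascal = solve-∀

binom-diag : ∀ n → binom n n ≡ 1
binom-diag zero = refl
binom-diag (suc n) = cong₂ ℕ._+_ (binom-diag n) (binom-vanish n (suc n) ℕP.≤-refl)

A^-coeff : ∀ k j → (A ^ suc k) j ≡ + binom (k ℕ.+ j) j
A^-coeff zero j = trans (·-identityʳ A j) (cong +_ (sym (binom-diag j)))
A^-coeff (suc k) zero = trans (ℤP.*-identityˡ ((A ^ suc k) 0)) (A^-coeff k zero)
A^-coeff (suc k) (suc j) = begin
  (A · A ^ suc k) (suc j)                              ≡⟨ A·-suc (A ^ suc k) j ⟩
  (A ^ suc k) (suc j) + (A ^ suc (suc k)) j            ≡⟨ cong₂ _+_ (A^-coeff k (suc j)) (A^-coeff (suc k) j) ⟩
  + binom (k ℕ.+ suc j) (suc j) + + binom (suc k ℕ.+ j) j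
    ≡⟨ cong (λ x → + binom (k ℕ.+ suc j) (suc j) + + binom x j) (sym (ℕP.+-suc k j)) ⟩
  + binom (k ℕ.+ suc j) (suc j) + + binom (k ℕ.+ suc j) j
    ≡⟨ sym (ℤP.pos-+ (binom (k ℕ.+ suc j) (suc j)) (binom (k ℕ.+ suc j) j)) ⟩
  + (binom (k ℕ.+ suc j) (suc j) ℕ.+ binom (k ℕ.+ suc j) j)
    ≡⟨ cong +_ (ℕP.+-comm (binom (k ℕ.+ suc j) (suc j)) (binom (k ℕ.+ suc j) j)) ⟩
  + binom (suc k ℕ.+ suc j) (suc j)                     ∎
  where open ≡-Reasoning

cnt : ℕ → ℕ → ℕ → ℕ
cnt n k p = countTrue (map (λ s → (length s ≡ᵇ k) ∧ ((p ℕ.+ sum s) % 2 ≡ᵇ 0)) (subsets n))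

countTrue-++ : ∀ xs ys → countTrue (xs ++ ys) ≡ countTrue xs ℕ.+ countTrue ys
countTrue-++ [] ys = refl
countTrue-++ (true ∷ xs) ys = cong suc (countTrue-++ xs ys)
countTrue-++ (false ∷ xs) ys = countTrue-++ xs ys

countTrue-none : ∀ {X : Set} (xs : List X) → countTrue (map (λ _ → false) xs) ≡ 0
countTrue-none [] = refl
countTrue-none (x ∷ xs) = countTrue-none xs

-- Subsets of {1,…,n+1} either avoid n+1 or are {n+1} ∪ s with s ⊆ {1,…,n}.
cnt-split : ∀ n k p → cnt (suc n) k p ≡
  cnt n k p ℕ.+ countTrue (map (λ s → (suc (length s) ≡ᵇ k) ∧ ((p ℕ.+ (suc n ℕ.+ sum s)) % 2 ≡ᵇ 0)) (subsets n))
cnt-split n k p =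
  trans (cong countTrue (ListP.map-++ P (subsets n) _))
        (trans (countTrue-++ (map P (subsets n)) _)
               (cong (λ xs → cnt n k p ℕ.+ countTrue xs) (sym (ListP.map-∘ (subsets n)))))
  where
  P : List ℕ → Bool
  P s = (length s ≡ᵇ k) ∧ ((p ℕ.+ sum s) % 2 ≡ᵇ 0)

cnt-zero : ∀ n p → cnt (suc n) 0 p ≡ cnt n 0 p
cnt-zero n p =
  trans (cnt-split n 0 p) (trans (cong (cnt n 0 p ℕ.+_) (countTrue-none (subsets n))) (ℕP.+-identityʳ _))

cnt-suc : ∀ n k p → cnt (suc n) (suc k) p ≡ cnt n (suc k) p ℕ.+ cnt n k (p ℕ.+ suc n)
cnt-suc n k p = trans (cnt-split n (suc k) p) (cong (λ xs → cnt n (suc k) p ℕ.+ countTrue xs)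
  (ListP.map-cong (λ s → cong (λ x → (length s ≡ᵇ k) ∧ (x % 2 ≡ᵇ 0)) (sym (ℕP.+-assoc p (suc n) (sum s))))
                  (subsets n)))

-- Every k-subset has one of the two parities.
cnt-total : ∀ n k p → cnt n k p ℕ.+ cnt n k (suc p) ≡ binom n k
cnt-total zero zero p rewrite ℕP.+-identityʳ p | parity-suc p with p % 2 ≡ᵇ 0
... | true = refl
... | false = refl
cnt-total zero (suc k) p = refl
cnt-total (suc n) zero p rewrite cnt-zero n p | cnt-zero n (suc p) = cnt-total n zero p
cnt-total (suc n) (suc k) p rewrite cnt-suc n k p | cnt-suc n k (suc p) =
  trans (regroup (cnt n (suc k) p) _ _ _) (cong₂ ℕ._+_ (cnt-total n k (p ℕ.+ suc n)) (cnt-total n (suc k) p))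
  where
  regroup : ∀ (a b c d : ℕ) → a ℕ.+ b ℕ.+ (c ℕ.+ d) ≡ (b ℕ.+ d) ℕ.+ (a ℕ.+ c)
  regroup = ℕSolver.solve-∀

signed : ℕ → ℕ → ℕ → ℤ
signed n k p = + cnt n k p - + cnt n k (suc p)

δ : ℕ → ℕ → ℤ
δ n k = signed n k 0

twice-e : ∀ n k → + e n k + + e n k ≡ + binom n k + δ n k
twice-e n k = begin
  + cnt n k 0 + + cnt n k 0                                     ≡⟨ split (+ cnt n k 0) (+ cnt n k 1) ⟩
  (+ cnt n k 0 + + cnt n k 1) + δ n k                           ≡⟨ cong (_+ δ n k) (sym (ℤP.pos-+ (cnt n k 0) _)) ⟩
  + (cnt n k 0 ℕ.+ cnt n k 1) + δ n k                           ≡⟨ cong (λ x → + x + δ n k) (cnt-total n k 0) ⟩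
  + binom n k + δ n k                                           ∎
  where
  open ≡-Reasoning
  split : ∀ (a b : ℤ) → a + a ≡ (a + b) + (a - b)
  split = solve-∀

-- As cnt is 2-periodic in p, the signed count changes sign with p.
signed-sign : ∀ n k p → signed n k p ≡ sign p * δ n k
signed-sign n k zero = sym (ℤP.*-identityˡ (δ n k))
signed-sign n k (suc p) = begin
  + cnt n k (suc p) - + cnt n k p  ≡⟨ flip (+ cnt n k p) (+ cnt n k (suc p)) ⟩
  - signed n k p                   ≡⟨ cong -_ (signed-sign n k p) ⟩
  - (sign p * δ n k)               ≡⟨ ℤP.neg-distribˡ-* (sign p) (δ n k) ⟩
  - sign p * δ n k                 ≡⟨ cong (_* δ n k) (sym (sign-suc p)) ⟩
  sign (suc p) * δ n k             ∎
  where
  open ≡-Reasoning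
  flip : ∀ (a b : ℤ) → b - a ≡ - (a - b)
  flip = solve-∀

-- Pascal's rule for δ: the element n+1 contributes the sign (-1)^(n+1).
δ-suc : ∀ n k → δ (suc n) (suc k) ≡ δ n (suc k) + sign (suc n) * δ n k
δ-suc n k rewrite cnt-suc n k 0 | cnt-suc n k 1 =
  trans (cong₂ _-_ (ℤP.pos-+ (cnt n (suc k) 0) _) (ℤP.pos-+ (cnt n (suc k) 1) _))
        (trans (interchange (+ cnt n (suc k) 0) (+ cnt n k (suc n)) (+ cnt n (suc k) 1) (+ cnt n k (suc (suc n))))
               (cong (_+_ (δ n (suc k))) (signed-sign n k (suc n))))
  where
  interchange : ∀ (a b c d : ℤ) → (a + b) - (c + d) ≡ (a - c) + (b - d)
  interchange = solve-∀

-- The empty subset is the only 0-subset, and there are no k-subsets for k > n.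
δ-zero : ∀ n → δ n 0 ≡ + 1
δ-zero zero = refl
δ-zero (suc n) rewrite cnt-zero n 0 | cnt-zero n 1 = δ-zero n

δ-vanish : ∀ n k → n < k → δ n k ≡ + 0
δ-vanish zero (suc k) _ = refl
δ-vanish (suc n) (suc k) (s≤s n<k) = begin
  δ (suc n) (suc k)                         ≡⟨ δ-suc n k ⟩
  δ n (suc k) + sign (suc n) * δ n k        ≡⟨ cong₂ (λ x y → x + sign (suc n) * y) (δ-vanish n (suc k) (ℕP.m<n⇒m<1+n n<k)) (δ-vanish n k n<k) ⟩
  + 0 + sign (suc n) * + 0                  ≡⟨ cong (_+_ (+ 0)) (ℤP.*-zeroʳ (sign (suc n))) ⟩
  + 0                                       ∎
  where open ≡-Reasoning

-- Two Pascal steps: the signs (-1)^(n+1), (-1)^(n+2) cancel to give (1+z²).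
δ-suc-suc : ∀ n j → δ (suc (suc n)) (suc (suc j)) ≡ δ n (suc (suc j)) - δ n j
δ-suc-suc n j = begin
  δ (suc (suc n)) (suc (suc j))
    ≡⟨ δ-suc (suc n) (suc j) ⟩
  δ (suc n) (suc (suc j)) + sign n * δ (suc n) (suc j)
    ≡⟨ cong₂ (λ x y → x + sign n * y) (δ-suc n (suc j)) (δ-suc n j) ⟩
  δ n (suc (suc j)) + sign (suc n) * δ n (suc j) + sign n * (δ n (suc j) + sign (suc n) * δ n j)
    ≡⟨ cong (λ s → δ n (suc (suc j)) + s * δ n (suc j) + sign n * (δ n (suc j) + s * δ n j)) (sign-suc n) ⟩
  δ n (suc (suc j)) + - sign n * δ n (suc j) + sign n * (δ n (suc j) + - sign n * δ n j)
    ≡⟨ expand (sign n) (δ n (suc (suc j))) (δ n (suc j)) (δ n j) ⟩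
  δ n (suc (suc j)) - (sign n * sign n) * δ n j
    ≡⟨ cong (λ x → δ n (suc (suc j)) - x * δ n j) (sign² n) ⟩
  δ n (suc (suc j)) - + 1 * δ n j
    ≡⟨ cong (_-_ (δ n (suc (suc j)))) (ℤP.*-identityˡ (δ n j)) ⟩
  δ n (suc (suc j)) - δ n j ∎
  where
  open ≡-Reasoning
  expand : ∀ (s a b c : ℤ) → a + - s * b + s * (b + - s * c) ≡ a - (s * s) * c
  expand = solve-∀
  sign² : ∀ n → sign n * sign n ≡ + 1
  sign² zero = refl
  sign² (suc zero) = refl
  sign² (suc (suc n)) = sign² n

-- At j = -1 the recurrence reads δ(n+2,1) = δ(n,1).
δ-suc-suc-one : ∀ n → δ (suc (suc n)) 1 ≡ δ n 1
δ-suc-suc-one n = begin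
  δ (suc (suc n)) 1                          ≡⟨ δ-suc (suc n) 0 ⟩
  δ (suc n) 1 + sign n * δ (suc n) 0         ≡⟨ cong₂ (λ x y → x + sign n * y) (δ-suc n 0) (δ-zero (suc n)) ⟩
  δ n 1 + sign (suc n) * δ n 0 + sign n * + 1 ≡⟨ cong₂ (λ s y → δ n 1 + s * y + sign n * + 1) (sign-suc n) (δ-zero n) ⟩
  δ n 1 + - sign n * + 1 + sign n * + 1       ≡⟨ cancel (sign n) (δ n 1) ⟩
  δ n 1                                      ∎
  where
  open ≡-Reasoning
  cancel : ∀ (s a : ℤ) → a + - s * + 1 + s * + 1 ≡ a
  cancel = solve-∀

-- D k = Σ_j δ(k+j,j) zʲ, determined by D₀ = (1-z)/(1+z²), D₁ = 1/(1+z²)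
-- and D_{k+2} = D_k/(1+z²).
D : ℕ → Series
D zero = B · U
D (suc zero) = B
D (suc (suc k)) = B · D k

D-coeff₀ : ∀ k → D k 0 ≡ + 1
D-coeff₀ zero = refl
D-coeff₀ (suc zero) = refl
D-coeff₀ (suc (suc k)) = trans (·-coeff₀ B (D k) refl) (D-coeff₀ k)

δ-diagonal : ∀ k j → δ (k ℕ.+ j) j ≡ D k j
δ-diagonal k zero rewrite ℕP.+-identityʳ k = trans (δ-zero k) (sym (D-coeff₀ k))
δ-diagonal zero (suc zero) = refl
δ-diagonal (suc zero) (suc zero) = refl
δ-diagonal (suc (suc k)) (suc zero) =
  trans (δ-suc-suc-one (k ℕ.+ 1)) (trans (δ-diagonal k 1) (sym (·-coeff₁ B (D k) refl refl)))
δ-diagonal zero (suc (suc j)) = begin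
  δ (suc (suc j)) (suc (suc j))        ≡⟨ δ-suc-suc j j ⟩
  δ j (suc (suc j)) - δ j j            ≡⟨ cong₂ _-_ (δ-vanish j (suc (suc j)) (ℕP.m<n⇒m<1+n ℕP.≤-refl)) (δ-diagonal zero j) ⟩
  + 0 - (B · U) j                      ≡⟨ sym (B·-suc-suc U j) ⟩
  (B · U) (suc (suc j))                ∎
  where open ≡-Reasoning
δ-diagonal (suc zero) (suc (suc j)) = begin
  δ (suc (suc (suc j))) (suc (suc j))  ≡⟨ δ-suc-suc (suc j) j ⟩
  δ (suc j) (suc (suc j)) - δ (suc j) j ≡⟨ cong₂ _-_ (δ-vanish (suc j) (suc (suc j)) ℕP.≤-refl) (δ-diagonal 1 j) ⟩
  + 0 - B j                             ≡⟨ ℤP.+-identityˡ (- B j) ⟩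
  - B j                                 ≡⟨ sym (B-suc-suc j) ⟩
  B (suc (suc j))                       ∎
  where open ≡-Reasoning
δ-diagonal (suc (suc k)) (suc (suc j)) = begin
  δ (suc (suc (k ℕ.+ suc (suc j)))) (suc (suc j))
    ≡⟨ δ-suc-suc (k ℕ.+ suc (suc j)) j ⟩
  δ (k ℕ.+ suc (suc j)) (suc (suc j)) - δ (k ℕ.+ suc (suc j)) j
    ≡⟨ cong₂ _-_ (δ-diagonal k (suc (suc j))) (trans (cong (λ x → δ x j) shift) (δ-diagonal (suc (suc k)) j)) ⟩
  D k (suc (suc j)) - D (suc (suc k)) j
    ≡⟨ sym (B·-suc-suc (D k) j) ⟩
  D (suc (suc k)) (suc (suc j)) ∎
  where
  open ≡-Reasoning
  shift : k ℕ.+ suc (suc j) ≡ suc (suc k) ℕ.+ j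
  shift = trans (ℕP.+-suc k (suc j)) (cong suc (ℕP.+-suc k j))

ê : ℕ → Series
ê k j = + e (k ℕ.+ j) j

twice-ê : ∀ k → twice (ê k) ≐ A ^ suc k ⊕ D k
twice-ê k j = trans (twice-e (k ℕ.+ j) j) (cong₂ _+_ (sym (A^-coeff k j)) (δ-diagonal k j))

losanitsch : ℕ → Series
losanitsch m j = sign j * + L m (+ j)

L-vanish : ∀ m j → m < j → L m (+ j) ≡ 0
L-vanish zero (suc j) _ = refl
L-vanish (suc zero) (suc zero) (s≤s ())
L-vanish (suc zero) (suc (suc j)) _ = refl
L-vanish (suc (suc m)) (suc (suc j)) (s≤s (s≤s m<j)) =
  cong₂ ℕ._+_ (cong₂ ℕ._+_ (L-vanish m (suc (suc j)) (ℕP.m<n⇒m<1+n (ℕP.m<n⇒m<1+n m<j)))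
                           (binom-vanish m (suc j) (ℕP.m<n⇒m<1+n m<j)))
              (L-vanish m j m<j)

Lpoly-z≐losanitsch : ∀ m → Lpoly-z m ≐ losanitsch m
Lpoly-z≐losanitsch m j with j ℕ.≤ᵇ m in j≤ᵇm
... | true = refl
... | false = sym (trans (cong (λ x → sign j * + x) (L-vanish m j m<j)) (ℤP.*-zeroʳ (sign j)))
  where
  m<j : m < j
  m<j = ℕP.≰⇒> (λ j≤m → subst T j≤ᵇm (ℕP.≤⇒≤ᵇ j≤m))

L-negative : ∀ m {i} → L m -[1+ i ] ≡ 0
L-negative zero = refl
L-negative (suc zero) = refl
L-negative (suc (suc m)) = refl

losanitsch-suc-suc : ∀ m → losanitsch (suc (suc m)) ≐ V · losanitsch m ⊕ minusZ · U ^ m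
losanitsch-suc-suc m zero = begin
  + 1 * + (L m (+ 0) ℕ.+ 0 ℕ.+ L m -[1+ 1 ])
    ≡⟨ cong (λ x → + 1 * + (L m (+ 0) ℕ.+ 0 ℕ.+ x)) (L-negative m) ⟩
  + 1 * + (L m (+ 0) ℕ.+ 0 ℕ.+ 0)
    ≡⟨ cong (λ x → + 1 * + x) (trans (ℕP.+-identityʳ _) (ℕP.+-identityʳ _)) ⟩
  + 1 * + L m (+ 0)
    ≡⟨ pad (+ L m (+ 0)) ((U ^ m) 0) ⟩
  (V · losanitsch m) 0 + (minusZ · U ^ m) 0 ∎
  where
  open ≡-Reasoning
  pad : ∀ (a u : ℤ) → + 1 * a ≡ + 1 * (+ 1 * a) + + 0 * u
  pad = solve-∀
losanitsch-suc-suc m (suc zero) = begin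
  - + 1 * + (L m (+ 1) ℕ.+ 1 ℕ.+ L m -[1+ 0 ])
    ≡⟨ cong (λ x → - + 1 * + (L m (+ 1) ℕ.+ 1 ℕ.+ x)) (L-negative m) ⟩
  - + 1 * + (L m (+ 1) ℕ.+ 1 ℕ.+ 0)
    ≡⟨ cong (λ x → - + 1 * + x) (ℕP.+-identityʳ _) ⟩
  - + 1 * + (L m (+ 1) ℕ.+ 1)
    ≡⟨ cong (- + 1 *_) (ℤP.pos-+ (L m (+ 1)) 1) ⟩
  - + 1 * (+ L m (+ 1) + + 1)
    ≡⟨ distribute (+ L m (+ 1)) ⟩
  - + 1 * + L m (+ 1) + - (+ 1 * + 1)
    ≡⟨ cong₂ _+_ (sym (·-coeff₁ V (losanitsch m) refl refl)) (cong -_ (sym (U^-coeff m 0))) ⟩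
  (V · losanitsch m) 1 + - (U ^ m) 0
    ≡⟨ cong (_+_ ((V · losanitsch m) 1)) (sym (minusZ·-suc (U ^ m) 0)) ⟩
  (V · losanitsch m) 1 + (minusZ · U ^ m) 1 ∎
  where
  open ≡-Reasoning
  distribute : ∀ (a : ℤ) → - + 1 * (a + + 1) ≡ - + 1 * a + - (+ 1 * + 1)
  distribute = solve-∀
losanitsch-suc-suc m (suc (suc j)) = begin
  sign j * + (L m (+ suc (suc j)) ℕ.+ binom m (suc j) ℕ.+ L m (+ j))
    ≡⟨ cong (sign j *_) (trans (ℤP.pos-+ _ (L m (+ j))) (cong (_+ + L m (+ j)) (ℤP.pos-+ (L m (+ suc (suc j))) _))) ⟩
  sign j * (+ L m (+ suc (suc j)) + + binom m (suc j) + + L m (+ j))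
    ≡⟨ distribute (sign j) _ _ _ ⟩
  (sign j * + L m (+ suc (suc j)) + sign j * + L m (+ j)) + - (- sign j * + binom m (suc j))
    ≡⟨ cong₂ _+_ (sym (V·-suc-suc (losanitsch m) j)) (cong (λ s → - (s * + binom m (suc j))) (sym (sign-suc j))) ⟩
  (V · losanitsch m) (suc (suc j)) + - (sign (suc j) * + binom m (suc j))
    ≡⟨ cong (_+_ ((V · losanitsch m) (suc (suc j)))) (trans (cong -_ (sym (U^-coeff m (suc j)))) (sym (minusZ·-suc (U ^ m) (suc j)))) ⟩
  (V · losanitsch m) (suc (suc j)) + (minusZ · U ^ m) (suc (suc j)) ∎
  where
  open ≡-Reasoning
  distribute : ∀ (s a b c : ℤ) → s * (a + b + c) ≡ (s * a + s * c) + - (- s * b)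
  distribute = solve-∀

-- Q m = (1-z)^(m mod 2) (1+z²)^⌊m/2⌋, the second summand of 2·L_m(-z).
Q : ℕ → Series
Q zero = oneS
Q (suc zero) = U
Q (suc (suc m)) = V · Q m

-- (3) 2·L_m(-z) = Q m + (1-z)ᵐ, using (1-z)² = (1+z²) - 2z.
twice-losanitsch : ∀ m → twice (losanitsch m) ≐ Q m ⊕ U ^ m
twice-losanitsch zero zero = refl
twice-losanitsch zero (suc j) = cong₂ _+_ (ℤP.*-zeroʳ (sign (suc j))) (ℤP.*-zeroʳ (sign (suc j)))
twice-losanitsch (suc zero) = ⊕-cong losanitsch-one (≐-trans losanitsch-one (≐-sym (·-identityʳ U)))
  where
  losanitsch-one : losanitsch 1 ≐ U
  losanitsch-one zero = refl
  losanitsch-one (suc zero) = refl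
  losanitsch-one (suc (suc j)) = ℤP.*-zeroʳ (sign j)
twice-losanitsch (suc (suc m)) = begin
  twice (losanitsch (suc (suc m)))
    ≈⟨ ⊕-cong (losanitsch-suc-suc m) (losanitsch-suc-suc m) ⟩
  twice (V · losanitsch m ⊕ minusZ · U ^ m)
    ≈⟨ collect V (losanitsch m) minusZ (U ^ m) ⟩
  V · twice (losanitsch m) ⊕ (minusZ ⊕ minusZ) · U ^ m
    ≈⟨ ⊕-cong (·-cong ≐-refl (twice-losanitsch m)) ≐-refl ⟩
  V · (Q m ⊕ U ^ m) ⊕ (minusZ ⊕ minusZ) · U ^ m
    ≈⟨ expand V (Q m) minusZ (U ^ m) ⟩
  V · Q m ⊕ (V ⊕ minusZ ⊕ minusZ) · U ^ m
    ≈⟨ ⊕-cong (≐-refl {V · Q m}) (≐-trans (·-cong (≐-sym U·U) ≐-refl) (·-assoc U U (U ^ m))) ⟩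
  Q (suc (suc m)) ⊕ U ^ suc (suc m) ∎
  where
  open ≐-Reasoning
  open SeriesSolver using (solve; _:=_; _:*_; _:+_)
  collect : ∀ v l z u → (v · l ⊕ z · u) ⊕ (v · l ⊕ z · u) ≐ v · (l ⊕ l) ⊕ (z ⊕ z) · u
  collect = solve 4 (λ v l z u → (v :* l :+ z :* u) :+ (v :* l :+ z :* u) := v :* (l :+ l) :+ (z :+ z) :* u) ≐-refl
  expand : ∀ v q z u → v · (q ⊕ u) ⊕ (z ⊕ z) · u ≐ v · q ⊕ (v ⊕ z ⊕ z) · u
  expand = solve 4 (λ v q z u → v :* (q :+ u) :+ (z :+ z) :* u := v :* q :+ (v :+ z :+ z) :* u) ≐-refl

halving : ∀ (X : ℕ → Series) g → (∀ m → X (suc (suc m)) ≐ g · X m) →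
          ∀ m → X m ≐ X (m % 2) · g ^ (m / 2)
halving X g step zero = ≐-sym (·-identityʳ (X 0))
halving X g step (suc zero) = ≐-sym (·-identityʳ (X 1))
halving X g step (suc (suc m)) rewrite half-suc-suc m = begin
  X (suc (suc m))                ≈⟨ step m ⟩
  g · X m                        ≈⟨ ·-congʳ g (halving X g step m) ⟩
  g · (X (m % 2) · g ^ (m / 2))  ≈⟨ rotate g (X (m % 2)) (g ^ (m / 2)) ⟩
  X (m % 2) · (g · g ^ (m / 2))  ∎
  where
  open ≐-Reasoning
  open SeriesSolver using (solve; _:=_; _:*_)
  rotate : ∀ a b c → a · (b · c) ≐ b · (a · c)
  rotate = solve 3 (λ a b c → a :* (b :* c) := b :* (a :* c)) ≐-refl

Q-parity : ∀ m → Q (m % 2) ≐ U ^ (m % 2)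
Q-parity zero = ≐-refl
Q-parity (suc zero) = ≐-sym (·-identityʳ U)
Q-parity (suc (suc m)) = Q-parity m

D-parity : ∀ m → D (m % 2) ≐ U ^ (1 ∸ m % 2) · B
D-parity zero = ≐-trans (·-comm B U) (·-cong (≐-sym (·-identityʳ U)) (≐-refl {B}))
D-parity (suc zero) = ≐-sym (·-identityˡ B)
D-parity (suc (suc m)) = D-parity m

half-plus-two : ∀ k → suc (suc k) / 2 ≡ k / 2 ℕ.+ 1
half-plus-two k = trans (half-suc-suc k) (ℕP.+-comm 1 (k / 2))

Q-closed : ∀ k → Q (k ℕ.+ 2) ≐ U ^ (k % 2) · V ^ (k / 2 ℕ.+ 1)
Q-closed k = begin
  Q (k ℕ.+ 2)                          ≈⟨ ≡⇒≐ (cong Q (ℕP.+-comm k 2)) ⟩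
  Q (suc (suc k))                      ≈⟨ halving Q V (λ _ → ≐-refl) (suc (suc k)) ⟩
  Q (k % 2) · V ^ (suc (suc k) / 2)    ≈⟨ ·-cong (Q-parity k) (≡⇒≐ (cong (V ^_) (half-plus-two k))) ⟩
  U ^ (k % 2) · V ^ (k / 2 ℕ.+ 1)      ∎
  where open ≐-Reasoning

D-closed : ∀ k → D k ≐ U ^ (1 ∸ k % 2) · B ^ (k / 2 ℕ.+ 1)
D-closed k = begin
  D k                                  ≈⟨ halving D B (λ _ → ≐-refl) k ⟩
  D (k % 2) · B ^ (k / 2)              ≈⟨ ·-cong (D-parity k) (≐-refl {B ^ (k / 2)}) ⟩
  (U ^ (1 ∸ k % 2) · B) · B ^ (k / 2)  ≈⟨ ·-assoc (U ^ (1 ∸ k % 2)) B (B ^ (k / 2)) ⟩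
  U ^ (1 ∸ k % 2) · B ^ suc (k / 2)    ≈⟨ ·-congʳ (U ^ (1 ∸ k % 2)) (≡⇒≐ (cong (B ^_) (ℕP.+-comm 1 (k / 2)))) ⟩
  U ^ (1 ∸ k % 2) · B ^ (k / 2 ℕ.+ 1)  ∎
  where open ≐-Reasoning

cancellation : ∀ r n s b →
  A ^ (r ℕ.+ n) · (B ^ b · (U ^ r · V ^ b ⊕ U ^ (r ℕ.+ n ℕ.+ s))) ≐ A ^ n ⊕ U ^ s · B ^ b
cancellation r n s b = begin
  A ^ (r ℕ.+ n) · (B ^ b · (U ^ r · V ^ b ⊕ U ^ (r ℕ.+ n ℕ.+ s)))
    ≈⟨ distribute (A ^ (r ℕ.+ n)) (B ^ b) (U ^ r) (V ^ b) (U ^ (r ℕ.+ n ℕ.+ s)) ⟩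
  (A ^ (r ℕ.+ n) · U ^ r) · (B ^ b · V ^ b) ⊕ (U ^ (r ℕ.+ n ℕ.+ s) · A ^ (r ℕ.+ n)) · B ^ b
    ≈⟨ ⊕-cong (·-cong (^-cancel A·U≐1 r n) (^-inverse B·V≐1 b)) (·-cong (^-cancel U·A≐1 (r ℕ.+ n) s) (≐-refl {B ^ b})) ⟩
  A ^ n · oneS ⊕ U ^ s · B ^ b
    ≈⟨ ⊕-cong (·-identityʳ (A ^ n)) (≐-refl {U ^ s · B ^ b}) ⟩
  A ^ n ⊕ U ^ s · B ^ b ∎
  where
  open ≐-Reasoning
  open SeriesSolver using (solve; _:=_; _:*_; _:+_)
  distribute : ∀ a b u v w → a · (b · (u · v ⊕ w)) ≐ (a · u) · (b · v) ⊕ (w · a) · b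
  distribute = solve 5 (λ a b u v w → a :* (b :* (u :* v :+ w)) := (a :* u) :* (b :* v) :+ (w :* a) :* b) ≐-refl
  A·U≐1 : A · U ≐ oneS
  A·U≐1 = ≐-trans (·-comm A U) U·A≐1

exponent-A : ∀ k → 2 ℕ.* ((k ℕ.+ 1) / 2) ℕ.+ 1 ≡ k % 2 ℕ.+ suc k
exponent-A zero = refl
exponent-A (suc zero) = refl
exponent-A (suc (suc k)) = begin
  2 ℕ.* (suc (suc (k ℕ.+ 1)) / 2) ℕ.+ 1   ≡⟨ cong (λ x → 2 ℕ.* x ℕ.+ 1) (half-suc-suc (k ℕ.+ 1)) ⟩
  2 ℕ.* suc ((k ℕ.+ 1) / 2) ℕ.+ 1         ≡⟨ unfold-double ((k ℕ.+ 1) / 2) ⟩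
  suc (suc (2 ℕ.* ((k ℕ.+ 1) / 2) ℕ.+ 1)) ≡⟨ cong (λ x → suc (suc x)) (exponent-A k) ⟩
  suc (suc (k % 2 ℕ.+ suc k))             ≡⟨ shift (k % 2) k ⟩
  k % 2 ℕ.+ suc (suc (suc k))             ∎
  where
  open ≡-Reasoning
  unfold-double : ∀ x → 2 ℕ.* suc x ℕ.+ 1 ≡ suc (suc (2 ℕ.* x ℕ.+ 1))
  unfold-double = ℕSolver.solve-∀
  shift : ∀ r k → suc (suc (r ℕ.+ suc k)) ≡ r ℕ.+ suc (suc (suc k))
  shift = ℕSolver.solve-∀

exponent-U : ∀ k → k ℕ.+ 2 ≡ k % 2 ℕ.+ suc k ℕ.+ (1 ∸ k % 2)
exponent-U zero = refl
exponent-U (suc zero) = refl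
exponent-U (suc (suc k)) = trans (cong (λ x → suc (suc x)) (exponent-U k)) (shift (k % 2) k (1 ∸ k % 2))
  where
  shift : ∀ r k s → suc (suc (r ℕ.+ suc k ℕ.+ s)) ≡ r ℕ.+ suc (suc (suc k)) ℕ.+ s
  shift = ℕSolver.solve-∀

twice-rhs : ∀ k → twice (rhsSeries k) ≐ zPow k · (A ^ suc k ⊕ D k)
twice-rhs k = begin
  twice (rhsSeries k)
    ≈⟨ ⊕-cong as-product as-product ⟩
  twice (zPow k · (A ^ a · (B ^ b · losanitsch (k ℕ.+ 2))))
    ≈⟨ double-inside (zPow k) (A ^ a) (B ^ b) (losanitsch (k ℕ.+ 2)) ⟩
  zPow k · (A ^ a · (B ^ b · twice (losanitsch (k ℕ.+ 2))))
    ≈⟨ ·-congʳ (zPow k) (·-congʳ (A ^ a) (·-congʳ (B ^ b) (twice-losanitsch (k ℕ.+ 2)))) ⟩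
  zPow k · (A ^ a · (B ^ b · (Q (k ℕ.+ 2) ⊕ U ^ (k ℕ.+ 2))))
    ≈⟨ ·-congʳ (zPow k) (·-cong (≡⇒≐ (cong (A ^_) (exponent-A k)))
                                (·-congʳ (B ^ b) (⊕-cong (Q-closed k) (≡⇒≐ (cong (U ^_) (exponent-U k)))))) ⟩
  zPow k · (A ^ (r ℕ.+ suc k) · (B ^ b · (U ^ r · V ^ b ⊕ U ^ (r ℕ.+ suc k ℕ.+ s))))
    ≈⟨ ·-congʳ (zPow k) (cancellation r (suc k) s b) ⟩
  zPow k · (A ^ suc k ⊕ U ^ s · B ^ b)
    ≈⟨ ·-congʳ (zPow k) (⊕-cong (≐-refl {A ^ suc k}) (≐-sym (D-closed k))) ⟩
  zPow k · (A ^ suc k ⊕ D k) ∎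
  where
  open ≐-Reasoning
  open SeriesSolver using (solve; _:=_; _:*_; _:+_)
  a = 2 ℕ.* ((k ℕ.+ 1) / 2) ℕ.+ 1
  b = k / 2 ℕ.+ 1
  r = k % 2
  s = 1 ∸ k % 2
  as-product : rhsSeries k ≐ zPow k · (A ^ a · (B ^ b · losanitsch (k ℕ.+ 2)))
  as-product =
    ≐-trans (⊛≐· (zPow k) _) (·-congʳ (zPow k)
      (≐-trans (⊛≐· (A ^S a) _) (·-cong (^S≐^ A a)
        (≐-trans (⊛≐· (B ^S b) _) (·-cong (^S≐^ B b) (Lpoly-z≐losanitsch (k ℕ.+ 2)))))))
  double-inside : ∀ x y w l → twice (x · (y · (w · l))) ≐ x · (y · (w · twice l))
  double-inside = solve 4 (λ x y w l → x :* (y :* (w :* l)) :+ x :* (y :* (w :* l)) := x :* (y :* (w :* (l :+ l)))) ≐-refl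

zPow-zero : zPow 0 ≐ oneS
zPow-zero zero = refl
zPow-zero (suc n) = refl

zPow-below : ∀ k g n → n < k → (zPow k · g) n ≡ + 0
zPow-below (suc k) g zero _ = ℤP.*-zeroˡ (g 0)
zPow-below (suc k) g (suc n) (s≤s n<k) = cong₂ _+_ (ℤP.*-zeroˡ (g (suc n))) (zPow-below k g n n<k)

zPow-at : ∀ k g j → (zPow k · g) (k ℕ.+ j) ≡ g j
zPow-at zero g j = trans (·-cong zPow-zero (≐-refl {g}) j) (·-identityˡ g j)
zPow-at (suc k) g j =
  trans (cong₂ _+_ (ℤP.*-zeroˡ (g (suc (k ℕ.+ j)))) (zPow-at k g j)) (ℤP.+-identityˡ (g j))

lhs-below : ∀ k n → n < k → lhsSeries k n ≡ + 0
lhs-below (suc k) n (s≤s n≤k) = cong (λ i → + eℤ n i) negative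
  where
  negative : + n - + suc k ≡ -[1+ k ∸ n ]
  negative = trans (ℤP.⊖-< (s≤s n≤k)) (cong (λ x → - (+ x)) (ℕP.+-∸-assoc 1 n≤k))

lhs-at : ∀ k j → lhsSeries k (k ℕ.+ j) ≡ (zPow k · ê k) (k ℕ.+ j)
lhs-at k j = trans (cong (λ i → + eℤ (k ℕ.+ j) i) difference) (sym (zPow-at k (ê k) j))
  where
  difference : + (k ℕ.+ j) - + k ≡ + j
  difference = trans (ℤP.m-n≡m⊖n (k ℕ.+ j) k) (trans (ℤP.⊖-≥ (ℕP.m≤m+n k j)) (cong +_ (ℕP.m+n∸m≡n k j)))

lhs≐ : ∀ k → lhsSeries k ≐ zPow k · ê k
lhs≐ k n with ℕP.<-≤-connex n k
... | inj₁ n<k = trans (lhs-below k n n<k) (sym (zPow-below k (ê k) n n<k))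
... | inj₂ k≤n = subst (λ m → lhsSeries k m ≡ (zPow k · ê k) m) (ℕP.m+[n∸m]≡n k≤n) (lhs-at k (n ∸ k))

twice-lhs : ∀ k → twice (lhsSeries k) ≐ zPow k · (A ^ suc k ⊕ D k)
twice-lhs k = begin
  twice (lhsSeries k)        ≈⟨ ⊕-cong (lhs≐ k) (lhs≐ k) ⟩
  twice (zPow k · ê k)       ≈⟨ ≐-sym (·-distribˡ (zPow k) (ê k) (ê k)) ⟩
  zPow k · twice (ê k)       ≈⟨ ·-congʳ (zPow k) (twice-ê k) ⟩
  zPow k · (A ^ suc k ⊕ D k) ∎
  where open ≐-Reasoning

double-injective : ∀ {x y : ℤ} → x + x ≡ y + y → x ≡ y
double-injective {x} {y} x+x≡y+y =
  ℤP.*-cancelˡ-≡ (+ 2) x y (trans (double x) (trans x+x≡y+y (sym (double y))))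
  where
  double : ∀ (z : ℤ) → + 2 * z ≡ z + z
  double = solve-∀

proposition3p4 : (k : ℕ) → (n : ℕ) → lhsSeries k n ≡ rhsSeries k n
proposition3p4 k n = double-injective (trans (twice-lhs k n) (sym (twice-rhs k n)))
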